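{- Let $q$ be an even prime power and let $G$ be a decodable graph representation (over $GF(q)$) with $n$ vertices and $m$ edges such that $u^G_{b_G}=b_G(n+1)+n-2m+1$. Let $\theta=b_G(n+1)+n-2m$. Then $$u^G_{b_G+y}\ge(\theta+1)\binom{m-b_G}{y}+(n-\theta)\binom{m-b_G-1}{y-1}$$ for every integer $y$ with $1\le y\le b_G-\max(\Omega(G),\Delta_L(G))-1$.
   Context: Graph representation of a coding scheme on packets $p_1,\dots,p_n\in GF(q)^\ell$ ($n\ge2$): vertices $p_1,\dots,p_n$, an edge joining $p_j,p_k$ per encoding $p_j+p_k$ ($j\ne k$), a loop at $p_j$ per encoding $p_j$ (multigraph, edges labelled distinctly). A spanning subgraph is decodable if the encodings of its edges determine $p_1,\dots,p_n$ uniquely, otherwise undecodable. For $G=(V,E)$ and integer $x$, $c^G_x$ counts $x$-subsets $X\subseteq E$ with $(V,E\setminus X)$ decodable, $u^G_x=\binom{m}{x}-c^G_x$. $b_G$ is the smallest $|\mathcal L|$, $\mathcal L\subseteq E$, with $(V,E\setminus\mathcal L)$ undecodable. $\Omega(G)$ is the maximum entry of the adjacency matrix of $G$ (maximum number of edges joining a pair of vertices, loops at a vertex counted as edges joining it to itself); $\Delta_L(G)$ is the maximum number of loops at a single vertex. -}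

module Defs where

open import Level using (Level)
open import Algebra.Bundles using (CommutativeRing)
open import Data.Nat as ℕ using (ℕ; zero; _∸_)
open import Data.Nat.Combinatorics using (_C_)
open import Data.Fin using (Fin)
open import Data.Fin.Subset using (Subset; _∈_; _∉_; ∣_∣; inside; outside)
open import Data.Vec using (Vec; []; _∷_; lookup)
open import Data.List using (List; []; _∷_; map; _++_; filter; length; foldr)
open import Data.Product using (Σ; ∃; _×_; _,_)
open import Data.Bool using (Bool; true; false)
open import Relation.Nullary using (¬_; Dec; yes; no)
open import Relation.Nullary.Decidable using (_×-dec_; ⌊_⌋)
open import Relation.Binary.PropositionalEquality using (_≡_; _≢_)
open import Data.Fin using (_≟_)

record Field (c ℓ : Level) : Set (Level.suc (c Level.⊔ ℓ)) where
  field
    commutativeRing : CommutativeRing c ℓ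
  open CommutativeRing commutativeRing public
  field
    nontrivial : ¬ (1# ≈ 0#)
    inverse    : ∀ x → ¬ (x ≈ 0#) → ∃ λ y → (x * y) ≈ 1#

record HasCardinality {c ℓ} (F : Field c ℓ) (q : ℕ) : Set (c Level.⊔ ℓ) where
  open Field F
  field
    enum       : Fin q → Carrier
    surjective : ∀ x → ∃ λ i → enum i ≈ x
    injective  : ∀ i j → enum i ≈ enum j → i ≡ j

-- Graph representations: vertices Fin n, edges a labelled list Vec (Edge n) m

data Edge (n : ℕ) : Set where
  loop : Fin n → Edge n
  link : (j k : Fin n) → j ≢ k → Edge n

module _ {c ℓ'} (F : Field c ℓ') where
  open Field F

  Packets : ℕ → ℕ → Set c
  Packets n ℓ = Fin n → Fin ℓ → Carrier

  encode : ∀ {n ℓ} → Edge n → Packets n ℓ → Fin ℓ → Carrier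
  encode (loop j)     p t = p j t
  encode (link j k _) p t = p j t + p k t

  DecodableSub : ∀ {n m} (ℓ : ℕ) → Vec (Edge n) m → Subset m → Set (c Level.⊔ ℓ')
  DecodableSub {n} ℓ E S =
    ∀ (p p' : Packets n ℓ) →
    (∀ i → i ∈ S → ∀ t → encode (lookup E i) p t ≈ encode (lookup E i) p' t) →
    ∀ j t → p j t ≈ p' j t

  Decodable : ∀ {n m} (ℓ : ℕ) → Vec (Edge n) m → Set (c Level.⊔ ℓ')
  Decodable ℓ E = DecodableSub ℓ E (Data.Vec.replicate _ inside)

complement : ∀ {m} → Subset m → Subset m
complement = Data.Fin.Subset.∁

allSubsets : ∀ m → List (Subset m)
allSubsets zero    = [] ∷ []
allSubsets (ℕ.suc m) = map (outside ∷_) (allSubsets m) ++ map (inside ∷_) (allSubsets m)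

module Counting {c ℓ'} (F : Field c ℓ') {n m : ℕ} (ℓ : ℕ) (E : Vec (Edge n) m)
    (dec : ∀ S → Dec (DecodableSub F ℓ E S)) where

  cG : ℕ → ℕ
  cG x = length (filter (λ X → (∣ X ∣ ℕ.≟ x) ×-dec dec (complement X)) (allSubsets m))

  uG : ℕ → ℕ
  uG x = (m C x) ∸ cG x

IsB : ∀ {c ℓ'} (F : Field c ℓ') {n m : ℕ} (ℓ : ℕ) → Vec (Edge n) m → ℕ → Set (c Level.⊔ ℓ')
IsB F {m = m} ℓ E b =
  (Σ (Subset m) λ L → ∣ L ∣ ≡ b × ¬ DecodableSub F ℓ E (complement L)) ×
  (∀ (L : Subset m) → ∣ L ∣ ℕ.< b → DecodableSub F ℓ E (complement L))

count : ∀ {A : Set} {m} → (A → Bool) → Vec A m → ℕ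
count P []       = 0
count P (x ∷ xs) with P x
... | true  = ℕ.suc (count P xs)
... | false = count P xs

joins : ∀ {n} → Fin n → Fin n → Edge n → Bool
joins a b (loop j)     = ⌊ a ≟ j ⌋ Data.Bool.∧ ⌊ b ≟ j ⌋
joins a b (link j k _) = (⌊ a ≟ j ⌋ Data.Bool.∧ ⌊ b ≟ k ⌋) Data.Bool.∨ (⌊ a ≟ k ⌋ Data.Bool.∧ ⌊ b ≟ j ⌋)

isLoopAt : ∀ {n} → Fin n → Edge n → Bool
isLoopAt a (loop j)     = ⌊ a ≟ j ⌋
isLoopAt a (link _ _ _) = false

maxOver : ∀ {n} → (Fin n → ℕ) → ℕ
maxOver {n} f = foldr ℕ._⊔_ 0 (map f (Data.List.allFin n))

Ω : ∀ {n m} → Vec (Edge n) m → ℕ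
Ω E = maxOver (λ a → maxOver (λ b → count (joins a b) E))

ΔL : ∀ {n m} → Vec (Edge n) m → ℕ
ΔL E = maxOver (λ a → count (isLoopAt a) E)

module Submission where

-- Over a field of characteristic 2 (which GF(q), q even, is) removing all loops leaves
-- G undecodable (the all-ones and all-zero packets agree on every p_j + p_k), and so does
-- removing the star of a vertex v (p_v is then unconstrained).  These n + 1 "blocking" edge
-- sets have sizes ≥ b_G adding up to 2m (handshake lemma), and two of them share at most
-- max(Ω(G), Δ_L(G)) edges.  Every set of removed edges containing a blocking set is
-- undecodable, and a set of fewer than 2 b_G − max(Ω, Δ_L) edges contains at most one, so
-- u_x ≥ Σ_i #{x-sets ⊇ B_i}.  If u_{b_G} is as small as the sizes allow, every blocking set
-- has size b_G or b_G + 1, exactly u_{b_G} = θ + 1 of them the former; counting their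
-- (b_G + y)-supersets gives the bound.

open import Defs
open import Data.Bool using (Bool; true; false; if_then_else_; _∧_; _∨_)
open import Data.Bool.Properties using (∧-zeroʳ; ∧-identityʳ; ¬-not; ∨-conicalˡ; ∨-conicalʳ)
open import Data.Empty using (⊥-elim) renaming (⊥ to Empty)
open import Data.Fin using (Fin; zero; suc; fromℕ<) renaming (_≟_ to _≟ᶠ_)
import Data.Fin.Properties as Fin
open import Data.Fin.Properties using () renaming (_<?_ to _<ᶠ?_)
open import Data.Fin.Permutation using (permutation)
open import Data.Fin.Subset using (Subset; inside; outside; ∣_∣; _⊆_; _∩_; _∪_; ∁; ⊥; _∈_)
open import Data.Fin.Subset.Properties
  using (_⊆?_; p⊆q⇒∣p∣≤∣q∣; x∈p∪q⁻; ∣p∣≤n; ⊆-min; ∣⊥∣≡0; p⊆q⇒∁p⊇∁q; x∈∁p⇒x∉p; ∩-comm)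
open import Data.List as List using (List; []; _∷_; map; _++_; filter; length)
open import Data.List.Properties using (map-++; map-∘; map-cong)
open import Data.List.Relation.Unary.Any using (Any; here; there)
open import Data.List.Membership.Propositional.Properties using (∈-allFin)
open import Data.Nat using (ℕ; zero; suc; _+_; _*_; _∸_; _⊔_; _≤_; _<_; z≤n; s≤s; _≟_)
open import Data.Nat.Combinatorics using (_C_; nCk+nC[k+1]≡[n+1]C[k+1])
import Data.Nat.Divisibility as Div
open import Data.Nat.ListAction using () renaming (sum to Σ-list)
open import Data.Nat.ListAction.Properties using () renaming (sum-++ to Σ-list-++)
open import Data.Nat.Properties as ℕ using (≤-refl; ≤-trans; +-mono-≤; module ≤-Reasoning)
open import Data.Product using (_×_; _,_; proj₁; proj₂)
open import Data.Sum using ([_,_])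
open import Data.Vec as Vec using (Vec; []; _∷_; lookup)
open import Data.Vec.Properties using (lookup⇒[]=; lookup-map)
open import Function using (_∘_)
open import Relation.Binary.Definitions using (tri<; tri≈; tri>)
open import Relation.Binary.PropositionalEquality
  using (_≡_; _≢_; refl; sym; trans; cong; cong₂; subst; module ≡-Reasoning)
open import Relation.Nullary using (Dec; ¬_; yes; no; does)
open import Relation.Nullary.Decidable using (dec-true; dec-false; _×-dec_; ⌊_⌋; isYes≗does)
open import Relation.Unary using (Pred; Decidable)
open import Algebra.Properties.CommutativeSemigroup ℕ.+-commutativeSemigroup
  using () renaming (interchange to +-interchange)
open import Algebra.Properties.Semiring.Sum ℕ.+-*-semiring
  using (sum; sum-cong-≗; ∑-distrib-+; *-distribʳ-sum; sum-permute)

𝟙 : Bool → ℕ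
𝟙 true  = 1
𝟙 false = 0

𝟙≤1 : ∀ b → 𝟙 b ≤ 1
𝟙≤1 true  = s≤s z≤n
𝟙≤1 false = z≤n

𝟙-yes : ∀ {P : Set} (P? : Dec P) → P → 𝟙 ⌊ P? ⌋ ≡ 1
𝟙-yes (yes _) _ = refl
𝟙-yes (no ¬p) p = ⊥-elim (¬p p)

𝟙-no : ∀ {P : Set} (P? : Dec P) → ¬ P → 𝟙 ⌊ P? ⌋ ≡ 0
𝟙-no (yes p) ¬p = ⊥-elim (¬p p)
𝟙-no (no _)  _  = refl

sum-mono : ∀ {K} {f g : Fin K → ℕ} → (∀ i → f i ≤ g i) → sum f ≤ sum g
sum-mono {zero}  f≤g = z≤n
sum-mono {suc K} f≤g = +-mono-≤ (f≤g zero) (sum-mono (λ i → f≤g (suc i)))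

sum-const : ∀ {K} c → sum {K} (λ _ → c) ≡ K * c
sum-const {zero}  c = refl
sum-const {suc K} c = cong (c +_) (sum-const {K} c)

sum-lower : ∀ {K} c {f : Fin K → ℕ} → (∀ i → c ≤ f i) → K * c ≤ sum f
sum-lower {K} c c≤f = subst (_≤ _) (sum-const {K} c) (sum-mono c≤f)

sum-upper : ∀ {K} c {f : Fin K → ℕ} → (∀ i → f i ≤ c) → sum f ≤ K * c
sum-upper {K} c f≤c = subst (_ ≤_) (sum-const {K} c) (sum-mono f≤c)

sum-zero : ∀ {K} {f : Fin K → ℕ} → (∀ i → f i ≡ 0) → sum f ≡ 0
sum-zero {zero}  f≡0 = refl
sum-zero {suc K} f≡0 = cong₂ _+_ (f≡0 zero) (sum-zero (λ i → f≡0 (suc i)))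

sum-δ : ∀ {K} (z : Fin K) → sum (λ i → 𝟙 ⌊ i ≟ᶠ z ⌋) ≡ 1
sum-δ {suc K} zero    = cong suc (sum-zero {K} (λ i → refl))
sum-δ {suc K} (suc z) = trans (sum-cong-≗ shift) (sum-δ z)
  where
  shift : ∀ i → 𝟙 ⌊ suc i ≟ᶠ suc z ⌋ ≡ 𝟙 ⌊ i ≟ᶠ z ⌋
  shift i with i ≟ᶠ z
  ... | yes _ = refl
  ... | no  _ = refl

at-most-one : ∀ {K} {P : Fin K → Set} (P? : ∀ i → Dec (P i)) →
              (∀ i j → i ≢ j → P i → P j → Empty) → sum (λ i → 𝟙 (does (P? i))) ≤ 1
at-most-one {zero}  P? excl = z≤n
at-most-one {suc K} P? excl with P? zero
... | no  _  = at-most-one (λ i → P? (suc i)) (λ i j i≢j → excl (suc i) (suc j) (λ eq → i≢j (Fin.suc-injective eq)))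
... | yes p0 = s≤s (ℕ.≤-reflexive (sum-zero others))
  where
  others : ∀ i → 𝟙 (does (P? (suc i))) ≡ 0
  others i = cong 𝟙 (dec-false (P? (suc i)) (excl zero (suc i) (λ ()) p0))

∑ₗ : ∀ {A : Set} → List A → (A → ℕ) → ℕ
∑ₗ xs f = Σ-list (map f xs)

∑ₗ-++ : ∀ {A : Set} (xs ys : List A) (f : A → ℕ) → ∑ₗ (xs ++ ys) f ≡ ∑ₗ xs f + ∑ₗ ys f
∑ₗ-++ xs ys f = trans (cong Σ-list (map-++ f xs ys)) (Σ-list-++ (map f xs) (map f ys))

∑ₗ-map : ∀ {A B : Set} (g : A → B) (xs : List A) (f : B → ℕ) → ∑ₗ (map g xs) f ≡ ∑ₗ xs (λ x → f (g x))
∑ₗ-map g xs f = cong Σ-list (sym (map-∘ xs))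

∑ₗ-cong : ∀ {A : Set} (xs : List A) {f g : A → ℕ} → (∀ x → f x ≡ g x) → ∑ₗ xs f ≡ ∑ₗ xs g
∑ₗ-cong xs f≡g = cong Σ-list (map-cong f≡g xs)

∑ₗ-mono : ∀ {A : Set} (xs : List A) {f g : A → ℕ} → (∀ x → f x ≤ g x) → ∑ₗ xs f ≤ ∑ₗ xs g
∑ₗ-mono []       f≤g = z≤n
∑ₗ-mono (x ∷ xs) f≤g = +-mono-≤ (f≤g x) (∑ₗ-mono xs f≤g)

∑ₗ-zero : ∀ {A : Set} (xs : List A) {f : A → ℕ} → (∀ x → f x ≡ 0) → ∑ₗ xs f ≡ 0
∑ₗ-zero []       f≡0 = refl
∑ₗ-zero (x ∷ xs) f≡0 = cong₂ _+_ (f≡0 x) (∑ₗ-zero xs f≡0)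

∑ₗ-+ : ∀ {A : Set} (xs : List A) (f g : A → ℕ) → ∑ₗ xs (λ x → f x + g x) ≡ ∑ₗ xs f + ∑ₗ xs g
∑ₗ-+ []       f g = refl
∑ₗ-+ (x ∷ xs) f g = trans (cong (λ r → f x + g x + r) (∑ₗ-+ xs f g)) (+-interchange (f x) (g x) _ _)

∑ₗ-sum : ∀ {A : Set} {K} (xs : List A) (f : Fin K → A → ℕ) →
         ∑ₗ xs (λ x → sum (λ i → f i x)) ≡ sum (λ i → ∑ₗ xs (f i))
∑ₗ-sum {K = K} [] f = sym (sum-zero {K} (λ i → refl))
∑ₗ-sum (x ∷ xs) f = trans (cong (λ r → sum (λ i → f i x) + r) (∑ₗ-sum xs f))
                          (sym (∑-distrib-+ (λ i → f i x) (λ i → ∑ₗ xs (f i))))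

length-filter : ∀ {A : Set} {p} {P : Pred A p} (P? : Decidable P) (xs : List A) →
                length (filter P? xs) ≡ ∑ₗ xs (λ x → 𝟙 (does (P? x)))
length-filter P? []       = refl
length-filter P? (x ∷ xs) with does (P? x)
... | true  = cong suc (length-filter P? xs)
... | false = length-filter P? xs

∣p∣+∣q∣≡∣p∪q∣+∣p∩q∣ : ∀ {m} (p q : Subset m) → ∣ p ∣ + ∣ q ∣ ≡ ∣ p ∪ q ∣ + ∣ p ∩ q ∣
∣p∣+∣q∣≡∣p∪q∣+∣p∩q∣ []            []            = refl
∣p∣+∣q∣≡∣p∪q∣+∣p∩q∣ (inside ∷ p)  (inside ∷ q)  = begin
  suc (∣ p ∣ + suc ∣ q ∣)         ≡⟨ cong suc (ℕ.+-suc ∣ p ∣ ∣ q ∣) ⟩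
  suc (suc (∣ p ∣ + ∣ q ∣))       ≡⟨ cong (λ r → suc (suc r)) (∣p∣+∣q∣≡∣p∪q∣+∣p∩q∣ p q) ⟩
  suc (suc (∣ p ∪ q ∣ + ∣ p ∩ q ∣)) ≡⟨ cong suc (ℕ.+-suc ∣ p ∪ q ∣ ∣ p ∩ q ∣) ⟨
  suc (∣ p ∪ q ∣ + suc ∣ p ∩ q ∣) ∎
  where open ≡-Reasoning
∣p∣+∣q∣≡∣p∪q∣+∣p∩q∣ (inside ∷ p)  (outside ∷ q) = cong suc (∣p∣+∣q∣≡∣p∪q∣+∣p∩q∣ p q)
∣p∣+∣q∣≡∣p∪q∣+∣p∩q∣ (outside ∷ p) (inside ∷ q)  =
  trans (ℕ.+-suc ∣ p ∣ ∣ q ∣) (cong suc (∣p∣+∣q∣≡∣p∪q∣+∣p∩q∣ p q))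
∣p∣+∣q∣≡∣p∪q∣+∣p∩q∣ (outside ∷ p) (outside ∷ q) = ∣p∣+∣q∣≡∣p∪q∣+∣p∩q∣ p q

∪-lub : ∀ {m} {p q r : Subset m} → p ⊆ r → q ⊆ r → p ∪ q ⊆ r
∪-lub {p = p} {q} p⊆r q⊆r x∈p∪q = [ p⊆r , q⊆r ] (x∈p∪q⁻ p q x∈p∪q)

two-subsets : ∀ {m} {p q X : Subset m} → p ⊆ X → q ⊆ X → ∣ p ∣ + ∣ q ∣ ≤ ∣ X ∣ + ∣ p ∩ q ∣
two-subsets {p = p} {q} {X} p⊆X q⊆X = begin
  ∣ p ∣ + ∣ q ∣         ≡⟨ ∣p∣+∣q∣≡∣p∪q∣+∣p∩q∣ p q ⟩
  ∣ p ∪ q ∣ + ∣ p ∩ q ∣ ≤⟨ +-mono-≤ (p⊆q⇒∣p∣≤∣q∣ (∪-lub p⊆X q⊆X)) ≤-refl ⟩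
  ∣ X ∣ + ∣ p ∩ q ∣     ∎
  where open ≤-Reasoning

supersets : ∀ {m} → Subset m → ℕ → ℕ
supersets {m} B x = ∑ₗ (allSubsets m) (λ X → 𝟙 (does (∣ X ∣ ≟ x ×-dec B ⊆? X)))

-- The number of subsets X ⊇ B with ∣ X ∣ + 1 = x: extending each by a new first
-- point gives the x-element supersets of 'inside ∷ B' (and some of 'outside ∷ B').
extended-supersets : ∀ {m} → Subset m → ℕ → ℕ
extended-supersets {m} B x = ∑ₗ (allSubsets m) (λ X → 𝟙 (does (suc ∣ X ∣ ≟ x ×-dec B ⊆? X)))

supersets-outside : ∀ {m} (B : Subset m) x →
                    supersets (outside ∷ B) x ≡ supersets B x + extended-supersets B x
supersets-outside {m} B x = trans (∑ₗ-++ (map (outside ∷_) (allSubsets m)) _ _)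
  (cong₂ _+_ (∑ₗ-map (outside ∷_) (allSubsets m) _) (∑ₗ-map (inside ∷_) (allSubsets m) _))

supersets-inside : ∀ {m} (B : Subset m) x → supersets (inside ∷ B) x ≡ extended-supersets B x
supersets-inside {m} B x = trans (∑ₗ-++ (map (outside ∷_) (allSubsets m)) _ _)
  (cong₂ _+_ (trans (∑ₗ-map (outside ∷_) (allSubsets m) _) (∑ₗ-zero (allSubsets m) λ X → cong 𝟙 (∧-zeroʳ _)))
             (∑ₗ-map (inside ∷_) (allSubsets m) _))

-- A superset of B has at least ∣ B ∣ elements.
extended-supersets-small : ∀ {m} (B : Subset m) x → x ≤ ∣ B ∣ → extended-supersets B x ≡ 0
extended-supersets-small {m} B x x≤∣B∣ = ∑ₗ-zero (allSubsets m) λ X →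
  cong 𝟙 (dec-false (suc ∣ X ∣ ≟ x ×-dec B ⊆? X) λ (size , B⊆X) →
    ℕ.<-irrefl refl (≤-trans (ℕ.≤-reflexive size) (≤-trans x≤∣B∣ (p⊆q⇒∣p∣≤∣q∣ {p = B} B⊆X))))

-- An (∣ B ∣ + k)-element superset of B is B together with k of the other m ∸ ∣ B ∣ points.
supersets-count : ∀ {m} (B : Subset m) k → supersets B (∣ B ∣ + k) ≡ (m ∸ ∣ B ∣) C k
supersets-count []           zero    = refl
supersets-count []           (suc k) = refl
supersets-count (inside ∷ B) k       = trans (supersets-inside B _) (supersets-count B k)
supersets-count {suc m} (outside ∷ B) zero = begin
  supersets (outside ∷ B) (∣ B ∣ + 0)
    ≡⟨ supersets-outside B _ ⟩
  supersets B (∣ B ∣ + 0) + extended-supersets B (∣ B ∣ + 0)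
    ≡⟨ cong₂ _+_ (supersets-count B 0) (extended-supersets-small B _ (ℕ.≤-reflexive (ℕ.+-identityʳ _))) ⟩
  (m ∸ ∣ B ∣) C 0 + 0
    ≡⟨⟩
  (suc m ∸ ∣ B ∣) C 0 ∎
  where open ≡-Reasoning
supersets-count {suc m} (outside ∷ B) (suc k) = begin
  supersets (outside ∷ B) (∣ B ∣ + suc k)
    ≡⟨ supersets-outside B _ ⟩
  supersets B (∣ B ∣ + suc k) + extended-supersets B (∣ B ∣ + suc k)
    ≡⟨ cong (λ x → supersets B (∣ B ∣ + suc k) + extended-supersets B x) (ℕ.+-suc ∣ B ∣ k) ⟩
  supersets B (∣ B ∣ + suc k) + supersets B (∣ B ∣ + k)
    ≡⟨ cong₂ _+_ (supersets-count B (suc k)) (supersets-count B k) ⟩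
  (m ∸ ∣ B ∣) C suc k + (m ∸ ∣ B ∣) C k
    ≡⟨ ℕ.+-comm ((m ∸ ∣ B ∣) C suc k) _ ⟩
  (m ∸ ∣ B ∣) C k + (m ∸ ∣ B ∣) C suc k
    ≡⟨ nCk+nC[k+1]≡[n+1]C[k+1] (m ∸ ∣ B ∣) k ⟩
  suc (m ∸ ∣ B ∣) C suc k
    ≡⟨ cong (_C suc k) (ℕ.+-∸-assoc 1 (∣p∣≤n B)) ⟨
  (suc m ∸ ∣ B ∣) C suc k ∎
  where open ≡-Reasoning

supersets-size : ∀ {m} (B : Subset m) {k x} → ∣ B ∣ + k ≡ x → supersets B x ≡ (m ∸ ∣ B ∣) C k
supersets-size B {k} refl = supersets-count B k

-- Every set is a superset of the empty set, so counting supersets of ⊥ counts all x-subsets.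
all-subsets-count : ∀ m x → ∑ₗ (allSubsets m) (λ X → 𝟙 (does (∣ X ∣ ≟ x))) ≡ m C x
all-subsets-count m x = begin
  ∑ₗ (allSubsets m) (λ X → 𝟙 (does (∣ X ∣ ≟ x)))  ≡⟨ ∑ₗ-cong (allSubsets m) ⊥⊆X ⟩
  supersets (⊥ {m}) x                            ≡⟨ cong (supersets (⊥ {m})) (cong (_+ x) (∣⊥∣≡0 m)) ⟨
  supersets (⊥ {m}) (∣ ⊥ {m} ∣ + x)               ≡⟨ supersets-count (⊥ {m}) x ⟩
  (m ∸ ∣ ⊥ {m} ∣) C x                             ≡⟨ cong (λ s → (m ∸ s) C x) (∣⊥∣≡0 m) ⟩
  m C x                                          ∎
  where
  open ≡-Reasoning
  ⊥⊆X : ∀ X → 𝟙 (does (∣ X ∣ ≟ x)) ≡ 𝟙 (does (∣ X ∣ ≟ x ×-dec ⊥ {m} ⊆? X))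
  ⊥⊆X X = cong 𝟙 (trans (sym (∧-identityʳ _)) (cong (does (∣ X ∣ ≟ x) ∧_) (sym (dec-true (⊥ {m} ⊆? X) (⊆-min X)))))

multiplicity : ∀ {K} → (Fin K → ℕ) → ℕ → ℕ
multiplicity s a = sum (λ i → 𝟙 ⌊ s i ≟ a ⌋)

-- For values s i ≥ b, every value other than b exceeds b by at least one ...
excess₁ : ∀ {K} (s : Fin K → ℕ) {b} → (∀ i → b ≤ s i) → K * suc b ≤ multiplicity s b + sum s
excess₁ {K} s {b} b≤s = ≤-trans (sum-lower (suc b) at-least) (ℕ.≤-reflexive (∑-distrib-+ (λ i → 𝟙 ⌊ s i ≟ b ⌋) s))
  where
  at-least : ∀ i → suc b ≤ 𝟙 ⌊ s i ≟ b ⌋ + s i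
  at-least i with s i ≟ b
  ... | yes sᵢ≡b = s≤s (ℕ.≤-reflexive (sym sᵢ≡b))
  ... | no  sᵢ≢b = ℕ.≤∧≢⇒< (b≤s i) (sᵢ≢b ∘ sym)

-- ... and every value other than b and b + 1 exceeds it by at least two.
excess₂ : ∀ {K} (s : Fin K → ℕ) {b} → (∀ i → b ≤ s i) →
          K * (2 + b) ≤ (multiplicity s b + multiplicity s (suc b)) + (multiplicity s b + sum s)
excess₂ {K} s {b} b≤s = ≤-trans (sum-lower (2 + b) at-least) (ℕ.≤-reflexive (begin
  sum (λ i → (𝟙 ⌊ s i ≟ b ⌋ + 𝟙 ⌊ s i ≟ suc b ⌋) + (𝟙 ⌊ s i ≟ b ⌋ + s i))
    ≡⟨ ∑-distrib-+ (λ i → 𝟙 ⌊ s i ≟ b ⌋ + 𝟙 ⌊ s i ≟ suc b ⌋) _ ⟩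
  sum (λ i → 𝟙 ⌊ s i ≟ b ⌋ + 𝟙 ⌊ s i ≟ suc b ⌋) + sum (λ i → 𝟙 ⌊ s i ≟ b ⌋ + s i)
    ≡⟨ cong₂ _+_ (∑-distrib-+ (λ i → 𝟙 ⌊ s i ≟ b ⌋) _) (∑-distrib-+ (λ i → 𝟙 ⌊ s i ≟ b ⌋) s) ⟩
  (multiplicity s b + multiplicity s (suc b)) + (multiplicity s b + sum s) ∎))
  where
  open ≡-Reasoning
  at-least : ∀ i → 2 + b ≤ (𝟙 ⌊ s i ≟ b ⌋ + 𝟙 ⌊ s i ≟ suc b ⌋) + (𝟙 ⌊ s i ≟ b ⌋ + s i)
  at-least i with s i ≟ b | s i ≟ suc b
  ... | yes sᵢ≡b | _        = s≤s (≤-trans (s≤s (ℕ.≤-reflexive (sym sᵢ≡b))) (ℕ.m≤n+m _ _))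
  ... | no  _    | yes sᵢ≡1+b = s≤s (ℕ.≤-reflexive (sym sᵢ≡1+b))
  ... | no  sᵢ≢b | no sᵢ≢1+b = ℕ.≤∧≢⇒< (ℕ.≤∧≢⇒< (b≤s i) (sᵢ≢b ∘ sym)) (sᵢ≢1+b ∘ sym)

trichotomy-count : ∀ {q} (a c : Fin q) → 𝟙 ⌊ a ≟ᶠ c ⌋ + (𝟙 ⌊ a <ᶠ? c ⌋ + 𝟙 ⌊ c <ᶠ? a ⌋) ≡ 1
trichotomy-count a c with Fin.<-cmp a c
... | tri< a<c a≢c c≮a rewrite 𝟙-no (a ≟ᶠ c) a≢c | 𝟙-yes (a <ᶠ? c) a<c | 𝟙-no (c <ᶠ? a) c≮a = refl
... | tri≈ a≮c a≡c c≮a rewrite 𝟙-yes (a ≟ᶠ c) a≡c | 𝟙-no (a <ᶠ? c) a≮c | 𝟙-no (c <ᶠ? a) c≮a = refl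
... | tri> a≮c a≢c c<a rewrite 𝟙-no (a ≟ᶠ c) a≢c | 𝟙-no (a <ᶠ? c) a≮c | 𝟙-yes (c <ᶠ? a) c<a = refl

-- An involution on Fin q with a single fixed point pairs up the other points, so q is odd:
-- q = 1 + #{i | σ i < i} + #{i | i < σ i}, and the last two counts agree (σ swaps them).
involution-odd : ∀ {q} (σ : Fin q → Fin q) → (∀ i → σ (σ i) ≡ i) →
                 (z : Fin q) → (∀ i → σ i ≡ i → i ≡ z) → σ z ≡ z → ¬ 2 Div.∣ q
involution-odd {q} σ σσ z fixed σz≡z (Div.divides d q≡d*2) = ℕ.even≢odd d k (begin
  2 * d            ≡⟨ ℕ.*-comm 2 d ⟩
  d * 2            ≡⟨ q≡d*2 ⟨
  q                ≡⟨ trans (sum-const {q} 1) (ℕ.*-identityʳ q) ⟨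
  sum {q} (λ _ → 1) ≡⟨ sum-cong-≗ (λ i → sym (trichotomy-count (σ i) i)) ⟩
  sum (λ i → 𝟙 ⌊ σ i ≟ᶠ i ⌋ + (𝟙 ⌊ σ i <ᶠ? i ⌋ + 𝟙 ⌊ i <ᶠ? σ i ⌋))
                   ≡⟨ ∑-distrib-+ (λ i → 𝟙 ⌊ σ i ≟ᶠ i ⌋) _ ⟩
  sum (λ i → 𝟙 ⌊ σ i ≟ᶠ i ⌋) + sum (λ i → 𝟙 ⌊ σ i <ᶠ? i ⌋ + 𝟙 ⌊ i <ᶠ? σ i ⌋)
                   ≡⟨ cong₂ _+_ one-fixed-point (∑-distrib-+ (λ i → 𝟙 ⌊ σ i <ᶠ? i ⌋) _) ⟩
  1 + (k + sum (λ i → 𝟙 ⌊ i <ᶠ? σ i ⌋))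
                   ≡⟨ cong (λ r → 1 + (k + r)) (sym swapped) ⟩
  1 + (k + k)      ≡⟨ cong (λ r → 1 + (k + r)) (ℕ.+-identityʳ k) ⟨
  suc (2 * k)      ∎)
  where
  open ≡-Reasoning
  k : ℕ
  k = sum (λ i → 𝟙 ⌊ σ i <ᶠ? i ⌋)

  one-fixed-point : sum (λ i → 𝟙 ⌊ σ i ≟ᶠ i ⌋) ≡ 1
  one-fixed-point = trans (sum-cong-≗ fixed-is-z) (sum-δ z)
    where
    fixed-is-z : ∀ i → 𝟙 ⌊ σ i ≟ᶠ i ⌋ ≡ 𝟙 ⌊ i ≟ᶠ z ⌋
    fixed-is-z i with i ≟ᶠ z
    ... | yes refl = 𝟙-yes (σ i ≟ᶠ i) σz≡z
    ... | no  i≢z  = 𝟙-no (σ i ≟ᶠ i) (i≢z ∘ fixed i)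

  swapped : k ≡ sum (λ i → 𝟙 ⌊ i <ᶠ? σ i ⌋)
  swapped = trans (sum-permute (λ i → 𝟙 ⌊ σ i <ᶠ? i ⌋) (permutation σ σ σσ σσ))
                  (sum-cong-≗ (λ i → cong (λ j → 𝟙 ⌊ j <ᶠ? σ i ⌋) (σσ i)))

module _ {c ℓ'} (F : Field c ℓ') where
  open Field F using (Carrier; _≈_; 1#; 0#; -_; setoid; inverse; ring; *-identityˡ; *-assoc; *-comm; *-congˡ; *-congʳ;
                      distribʳ; zeroʳ; -‿inverseʳ; -‿cong; +-cong; +-congˡ)
    renaming (_+_ to _+ᶠ_; _*_ to _*ᶠ_; refl to ≈-refl; trans to ≈-trans; sym to ≈-sym; reflexive to ≈-reflexive)
  open import Algebra.Properties.Ring ring using (-‿involutive; -0#≈0#)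
  open import Relation.Binary.Reasoning.Setoid setoid

  self-negative : ¬ (1# +ᶠ 1# ≈ 0#) → ∀ x → x ≈ - x → x ≈ 0#
  self-negative 2≉0 x x≈-x = begin
    x                 ≈⟨ *-identityˡ x ⟨
    1# *ᶠ x           ≈⟨ *-congʳ (≈-trans (≈-sym 2h≈1) (*-comm two h)) ⟩
    (h *ᶠ two) *ᶠ x   ≈⟨ *-assoc h two x ⟩
    h *ᶠ (two *ᶠ x)   ≈⟨ *-congˡ (≈-trans (distribʳ x 1# 1#) (+-cong (*-identityˡ x) (*-identityˡ x))) ⟩
    h *ᶠ (x +ᶠ x)     ≈⟨ *-congˡ (+-congˡ x≈-x) ⟩
    h *ᶠ (x +ᶠ - x)   ≈⟨ *-congˡ (-‿inverseʳ x) ⟩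
    h *ᶠ 0#           ≈⟨ zeroʳ h ⟩
    0#                ∎
    where
    two h : Carrier
    two = 1# +ᶠ 1#
    h = proj₁ (inverse two 2≉0)
    2h≈1 : two *ᶠ h ≈ 1#
    2h≈1 = proj₂ (inverse two 2≉0)

  module _ {q} (card : HasCardinality F q) where
    open HasCardinality card

    index : Carrier → Fin q
    index x = proj₁ (surjective x)

    enum-index : ∀ x → enum (index x) ≈ x
    enum-index x = proj₂ (surjective x)

    ≈-dec : ∀ x y → Dec (x ≈ y)
    ≈-dec x y with index x ≟ᶠ index y
    ... | yes eq = yes (≈-trans (≈-sym (enum-index x)) (≈-trans (≈-reflexive (cong enum eq)) (enum-index y)))
    ... | no  ne = no (λ x≈y → ne (injective _ _ (≈-trans (enum-index x) (≈-trans x≈y (≈-sym (enum-index y))))))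

    -- A field with an even number of elements has characteristic 2: otherwise negation
    -- would be an involution of the q elements fixing only 0.
    even-characteristic-two : 2 Div.∣ q → 1# +ᶠ 1# ≈ 0#
    even-characteristic-two 2∣q with ≈-dec (1# +ᶠ 1#) 0#
    ... | yes 2≈0 = 2≈0
    ... | no  2≉0 = ⊥-elim (involution-odd σ σσ (index 0#) fixed σ0 2∣q)
      where
      σ : Fin q → Fin q
      σ i = index (- enum i)

      enum-σ : ∀ i → enum (σ i) ≈ - enum i
      enum-σ i = enum-index (- enum i)

      σσ : ∀ i → σ (σ i) ≡ i
      σσ i = injective _ _ (≈-trans (enum-σ (σ i)) (≈-trans (-‿cong (enum-σ i)) (-‿involutive (enum i))))

      fixed : ∀ i → σ i ≡ i → i ≡ index 0#
      fixed i σi≡i = injective _ _ (≈-trans (self-negative 2≉0 (enum i) enum-i≈-enum-i) (≈-sym (enum-index 0#)))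
        where
        enum-i≈-enum-i : enum i ≈ - enum i
        enum-i≈-enum-i = ≈-trans (≈-reflexive (cong enum (sym σi≡i))) (enum-σ i)

      σ0 : σ (index 0#) ≡ index 0#
      σ0 = injective _ _ (≈-trans (enum-σ _) (≈-trans (-‿cong (enum-index 0#)) (≈-trans -0#≈0# (≈-sym (enum-index 0#)))))

touches : ∀ {n} → Fin n → Edge n → Bool
touches v (loop j)     = ⌊ v ≟ᶠ j ⌋
touches v (link j k _) = ⌊ v ≟ᶠ j ⌋ ∨ ⌊ v ≟ᶠ k ⌋

isLoop : ∀ {n} → Edge n → Bool
isLoop (loop _)     = true
isLoop (link _ _ _) = false

star : ∀ {n m} → Vec (Edge n) m → Fin n → Subset m
star E v = Vec.map (touches v) E

loops : ∀ {n m} → Vec (Edge n) m → Subset m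
loops E = Vec.map isLoop E

∈∁-map : ∀ {A : Set} {m} (P : A → Bool) (xs : Vec A m) {i} → i ∈ ∁ (Vec.map P xs) → P (lookup xs i) ≡ false
∈∁-map P xs {i} i∈∁ = ¬-not λ Pxᵢ → x∈∁p⇒x∉p i∈∁ (lookup⇒[]= i (Vec.map P xs) (trans (lookup-map i P xs) Pxᵢ))

count-cons : ∀ {A : Set} {m} (P : A → Bool) x (xs : Vec A m) → count P (x ∷ xs) ≡ 𝟙 (P x) + count P xs
count-cons P x xs with P x
... | true  = refl
... | false = refl

count-mono : ∀ {A : Set} {m} {P Q : A → Bool} → (∀ x → P x ≡ true → Q x ≡ true) →
             (xs : Vec A m) → count P xs ≤ count Q xs
count-mono P⇒Q []       = z≤n
count-mono {P = P} {Q} P⇒Q (x ∷ xs) rewrite count-cons P x xs | count-cons Q x xs with P x in Px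
... | true  rewrite P⇒Q x Px = s≤s (count-mono P⇒Q xs)
... | false = ℕ.m≤n⇒m≤o+n (𝟙 (Q x)) (count-mono P⇒Q xs)

∣map∣≡count : ∀ {A : Set} {m} (P : A → Bool) (xs : Vec A m) → ∣ Vec.map P xs ∣ ≡ count P xs
∣map∣≡count P []       = refl
∣map∣≡count P (x ∷ xs) with P x
... | true  = cong suc (∣map∣≡count P xs)
... | false = ∣map∣≡count P xs

map∩map : ∀ {A : Set} {m} (P Q : A → Bool) (xs : Vec A m) →
          Vec.map P xs ∩ Vec.map Q xs ≡ Vec.map (λ x → P x ∧ Q x) xs
map∩map P Q []       = refl
map∩map P Q (x ∷ xs) = cong (P x ∧ Q x ∷_) (map∩map P Q xs)

overlap-bound : ∀ {A : Set} {m} (P Q R : A → Bool) → (∀ x → P x ∧ Q x ≡ true → R x ≡ true) →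
                (xs : Vec A m) → ∣ Vec.map P xs ∩ Vec.map Q xs ∣ ≤ count R xs
overlap-bound P Q R P∧Q⇒R xs = begin
  ∣ Vec.map P xs ∩ Vec.map Q xs ∣          ≡⟨ cong ∣_∣ (map∩map P Q xs) ⟩
  ∣ Vec.map (λ x → P x ∧ Q x) xs ∣         ≡⟨ ∣map∣≡count _ xs ⟩
  count (λ x → P x ∧ Q x) xs              ≤⟨ count-mono P∧Q⇒R xs ⟩
  count R xs                              ∎
  where open ≤-Reasoning

-- An edge at two distinct vertices joins them.  (In the clauses returning at-both the
-- hypothesis has reduced to the goal itself.)
touches-joins : ∀ {n} {v w : Fin n} → v ≢ w → ∀ e → touches v e ∧ touches w e ≡ true → joins v w e ≡ true
touches-joins v≢w (loop j) at-both = at-both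
touches-joins {v = v} {w} v≢w (link j k _) at-both with v ≟ᶠ j | w ≟ᶠ j
... | yes refl | yes refl = ⊥-elim (v≢w refl)
... | yes refl | no _     rewrite at-both = refl
... | no _     | yes refl = at-both
... | no _     | no _     with v ≟ᶠ k | w ≟ᶠ k
...   | yes refl | yes refl = ⊥-elim (v≢w refl)
...   | yes _    | no _     = at-both
...   | no _     | _        = at-both

loop-touches : ∀ {n} (v : Fin n) e → isLoop e ∧ touches v e ≡ true → isLoopAt v e ≡ true
loop-touches v (loop j)     loop-at-v = loop-at-v
loop-touches v (link _ _ _) ()

maxOver≥ : ∀ {n} (f : Fin n → ℕ) a → f a ≤ maxOver f
maxOver≥ {n} f a = foldr-max (List.allFin n) (∈-allFin a)
  where
  foldr-max : ∀ xs → Any (a ≡_) xs → f a ≤ List.foldr _⊔_ 0 (map f xs)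
  foldr-max (x ∷ xs) (here refl) = ℕ.m≤m⊔n (f a) _
  foldr-max (x ∷ xs) (there a∈xs) = ≤-trans (foldr-max xs a∈xs) (ℕ.m≤n⊔m (f x) _)

star∩star≤Ω : ∀ {n m} (E : Vec (Edge n) m) {v w} → v ≢ w → ∣ star E v ∩ star E w ∣ ≤ Ω E
star∩star≤Ω E {v} {w} v≢w = ≤-trans (overlap-bound (touches v) (touches w) (joins v w) (touches-joins v≢w) E)
  (≤-trans (maxOver≥ (λ w → count (joins v w) E) w) (maxOver≥ (λ v → maxOver (λ w → count (joins v w) E)) v))

loops∩star≤ΔL : ∀ {n m} (E : Vec (Edge n) m) v → ∣ loops E ∩ star E v ∣ ≤ ΔL E
loops∩star≤ΔL E v = ≤-trans (overlap-bound isLoop (touches v) (isLoopAt v) (loop-touches v) E)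
  (maxOver≥ (λ v → count (isLoopAt v) E) v)

-- Every edge is counted twice: a loop once as a loop and once at its vertex, a link at its two ends.
edge-degree : ∀ {n} (e : Edge n) → 𝟙 (isLoop e) + sum (λ v → 𝟙 (touches v e)) ≡ 2
edge-degree (loop j)       = cong suc (sum-δ j)
edge-degree (link j k j≢k) = begin
  sum (λ v → 𝟙 (⌊ v ≟ᶠ j ⌋ ∨ ⌊ v ≟ᶠ k ⌋))             ≡⟨ sum-cong-≗ ends-distinct ⟩
  sum (λ v → 𝟙 ⌊ v ≟ᶠ j ⌋ + 𝟙 ⌊ v ≟ᶠ k ⌋)            ≡⟨ ∑-distrib-+ (λ v → 𝟙 ⌊ v ≟ᶠ j ⌋) _ ⟩
  sum (λ v → 𝟙 ⌊ v ≟ᶠ j ⌋) + sum (λ v → 𝟙 ⌊ v ≟ᶠ k ⌋) ≡⟨ cong₂ _+_ (sum-δ j) (sum-δ k) ⟩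
  2                                                  ∎
  where
  open ≡-Reasoning
  ends-distinct : ∀ v → 𝟙 (⌊ v ≟ᶠ j ⌋ ∨ ⌊ v ≟ᶠ k ⌋) ≡ 𝟙 ⌊ v ≟ᶠ j ⌋ + 𝟙 ⌊ v ≟ᶠ k ⌋
  ends-distinct v with v ≟ᶠ j | v ≟ᶠ k
  ... | yes refl | yes refl = ⊥-elim (j≢k refl)
  ... | yes _    | no _     = refl
  ... | no _     | yes _    = refl
  ... | no _     | no _     = refl

handshake : ∀ {n m} (E : Vec (Edge n) m) → count isLoop E + sum (λ v → count (touches v) E) ≡ 2 * m
handshake {n} []      = sum-zero {n} (λ v → refl)
handshake {n} {suc m} (e ∷ E) = begin
  count isLoop (e ∷ E) + sum (λ v → count (touches v) (e ∷ E))
    ≡⟨ cong₂ _+_ (count-cons isLoop e E) (sum-cong-≗ (λ v → count-cons (touches v) e E)) ⟩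
  (𝟙 (isLoop e) + count isLoop E) + sum (λ v → 𝟙 (touches v e) + count (touches v) E)
    ≡⟨ cong (λ r → 𝟙 (isLoop e) + count isLoop E + r) (∑-distrib-+ (λ v → 𝟙 (touches v e)) _) ⟩
  (𝟙 (isLoop e) + count isLoop E) + (sum (λ v → 𝟙 (touches v e)) + sum (λ v → count (touches v) E))
    ≡⟨ +-interchange (𝟙 (isLoop e)) _ _ _ ⟩
  (𝟙 (isLoop e) + sum (λ v → 𝟙 (touches v e))) + (count isLoop E + sum (λ v → count (touches v) E))
    ≡⟨ cong₂ _+_ (edge-degree e) (handshake E) ⟩
  2 + 2 * m
    ≡⟨ ℕ.*-suc 2 m ⟨
  2 * suc m ∎
  where open ≡-Reasoning

-- The n + 1 edge sets whose removal certainly destroys decodability (in characteristic 2):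
-- the loops, and the star of each vertex.
blocking : ∀ {n m} → Vec (Edge n) m → Fin (suc n) → Subset m
blocking E zero    = loops E
blocking E (suc v) = star E v

blocking-sizes : ∀ {n m} (E : Vec (Edge n) m) → sum (λ i → ∣ blocking E i ∣) ≡ 2 * m
blocking-sizes E = trans (cong₂ _+_ (∣map∣≡count isLoop E) (sum-cong-≗ (λ v → ∣map∣≡count (touches v) E))) (handshake E)

blocking-overlap : ∀ {n m} (E : Vec (Edge n) m) {i j} → i ≢ j → ∣ blocking E i ∩ blocking E j ∣ ≤ Ω E ⊔ ΔL E
blocking-overlap E {zero}  {zero}  i≢j = ⊥-elim (i≢j refl)
blocking-overlap E {zero}  {suc w} _   = ≤-trans (loops∩star≤ΔL E w) (ℕ.m≤n⊔m (Ω E) (ΔL E))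
blocking-overlap E {suc v} {zero}  _   = ≤-trans (ℕ.≤-reflexive (cong ∣_∣ (∩-comm (star E v) (loops E))))
                                                  (≤-trans (loops∩star≤ΔL E v) (ℕ.m≤n⊔m (Ω E) (ΔL E)))
blocking-overlap E {suc v} {suc w} v≢w = ≤-trans (star∩star≤Ω E (λ v≡w → v≢w (cong suc v≡w))) (ℕ.m≤m⊔n (Ω E) (ΔL E))

module _ {c ℓ'} (F : Field c ℓ') where
  open Field F using (_≈_; 1#; 0#; nontrivial; +-identityˡ)
    renaming (_+_ to _+ᶠ_; refl to ≈-refl; trans to ≈-trans; sym to ≈-sym)

  decodable-mono : ∀ {n m ℓ} {E : Vec (Edge n) m} {S T : Subset m} →
                   S ⊆ T → DecodableSub F ℓ E S → DecodableSub F ℓ E T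
  decodable-mono S⊆T decS p p' agree = decS p p' (λ i i∈S → agree i (S⊆T i∈S))

  undecodable-superset : ∀ {n m ℓ} {E : Vec (Edge n) m} {B X : Subset m} → B ⊆ X →
                         ¬ DecodableSub F ℓ E (∁ B) → ¬ DecodableSub F ℓ E (∁ X)
  undecodable-superset {E = E} B⊆X undecB decX = undecB (decodable-mono {E = E} (p⊆q⇒∁p⊇∁q B⊆X) decX)

  -- Without the edges at v nothing is known about p_v: the packets δ_v and 0 agree on
  -- every remaining encoding.
  star-undecodable : ∀ {n m ℓ} → Fin ℓ → (E : Vec (Edge n) m) (v : Fin n) → ¬ DecodableSub F ℓ E (∁ (star E v))
  star-undecodable t E v decodable = nontrivial 1≈0
    where
    δ : Packets F _ _
    δ j _ = if ⌊ v ≟ᶠ j ⌋ then 1# else 0#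

    0ᵖ : Packets F _ _
    0ᵖ _ _ = 0#

    agree-off-v : ∀ e → touches v e ≡ false → ∀ t → encode F e δ t ≈ encode F e 0ᵖ t
    agree-off-v (loop j) v∉e t rewrite v∉e = ≈-refl
    agree-off-v (link j k _) v∉e t
      rewrite ∨-conicalˡ ⌊ v ≟ᶠ j ⌋ _ v∉e | ∨-conicalʳ ⌊ v ≟ᶠ j ⌋ _ v∉e = ≈-refl

    1≈0 : 1# ≈ 0#
    1≈0 with decodable δ 0ᵖ (λ i i∈S → agree-off-v (lookup E i) (∈∁-map (touches v) E i∈S)) v t
    ... | δᵥ≈0 rewrite isYes≗does (v ≟ᶠ v) | dec-true (v ≟ᶠ v) refl = δᵥ≈0

  -- In characteristic 2 the all-ones and all-zero packets agree on every p_j + p_k,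
  -- so the links alone never determine the packets.
  loops-undecodable : ∀ {n m ℓ} → Fin ℓ → Fin n → 1# +ᶠ 1# ≈ 0# →
                      (E : Vec (Edge n) m) → ¬ DecodableSub F ℓ E (∁ (loops E))
  loops-undecodable t v 1+1≈0 E decodable = nontrivial (decodable 1ᵖ 0ᵖ agree-on-links v t)
    where
    1ᵖ 0ᵖ : Packets F _ _
    1ᵖ _ _ = 1#
    0ᵖ _ _ = 0#

    agree-on-links : ∀ i → i ∈ ∁ (loops E) → ∀ t → encode F (lookup E i) 1ᵖ t ≈ encode F (lookup E i) 0ᵖ t
    agree-on-links i i∈S t with lookup E i | ∈∁-map isLoop E i∈S
    ... | link _ _ _ | _ = ≈-trans 1+1≈0 (≈-sym (+-identityˡ 0#))

  blocking-undecodable : ∀ {n m ℓ} → Fin ℓ → Fin n → 1# +ᶠ 1# ≈ 0# →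
                         (E : Vec (Edge n) m) (i : Fin (suc n)) → ¬ DecodableSub F ℓ E (∁ (blocking E i))
  blocking-undecodable t v 1+1≈0 E zero    = loops-undecodable t v 1+1≈0 E
  blocking-undecodable t v 1+1≈0 E (suc w) = star-undecodable t E w

module _ {c ℓ'} (F : Field c ℓ') {n m} (ℓ : ℕ) (E : Vec (Edge n) m)
         (dec : ∀ S → Dec (DecodableSub F ℓ E S)) where
  open Counting F ℓ E dec

  -- If removing any B i destroys decodability, then so does removing any superset of B i;
  -- when no x-set contains two of the B i, these x-sets are counted once each, giving
  -- a lower bound on u_x.
  undecodable-supersets : ∀ {K} (B : Fin K → Subset m) → (∀ i → ¬ DecodableSub F ℓ E (∁ (B i))) →
                          ∀ x → (∀ i j X → i ≢ j → B i ⊆ X → B j ⊆ X → ∣ X ∣ ≢ x) →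
                          sum (λ i → supersets (B i) x) ≤ uG x
  undecodable-supersets {K} B undec x separated = ℕ.m+n≤o⇒m≤o∸n (sum (λ i → supersets (B i) x)) (begin
    sum (λ i → supersets (B i) x) + cG x
      ≡⟨ ℕ.+-comm _ (cG x) ⟩
    cG x + sum (λ i → supersets (B i) x)
      ≡⟨ cong₂ _+_ (length-filter (λ X → ∣ X ∣ ≟ x ×-dec dec (∁ X)) (allSubsets m))
                   (sym (∑ₗ-sum (allSubsets m) contains)) ⟩
    ∑ₗ (allSubsets m) decodable-x-set + ∑ₗ (allSubsets m) (λ X → sum (λ i → contains i X))
      ≡⟨ ∑ₗ-+ (allSubsets m) decodable-x-set _ ⟨
    ∑ₗ (allSubsets m) (λ X → decodable-x-set X + sum (λ i → contains i X))
      ≤⟨ ∑ₗ-mono (allSubsets m) counted-once ⟩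
    ∑ₗ (allSubsets m) (λ X → 𝟙 (does (∣ X ∣ ≟ x)))
      ≡⟨ all-subsets-count m x ⟩
    m C x ∎)
    where
    open ≤-Reasoning
    decodable-x-set : Subset m → ℕ
    decodable-x-set X = 𝟙 (does (∣ X ∣ ≟ x ×-dec dec (∁ X)))
    contains : Fin K → Subset m → ℕ
    contains i X = 𝟙 (does (∣ X ∣ ≟ x ×-dec B i ⊆? X))
    counted-once : ∀ X → decodable-x-set X + sum (λ i → contains i X) ≤ 𝟙 (does (∣ X ∣ ≟ x))
    counted-once X with ∣ X ∣ ≟ x
    ... | no ∣X∣≢x rewrite dec-false (∣ X ∣ ≟ x) ∣X∣≢x = ℕ.≤-reflexive (sum-zero {K} (λ i → refl))
    ... | yes ∣X∣≡x rewrite dec-true (∣ X ∣ ≟ x) ∣X∣≡x with dec (∁ X)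
    ...   | yes decodable = s≤s (ℕ.≤-reflexive (sum-zero {K} λ i →
              cong 𝟙 (dec-false (B i ⊆? X) (λ Bᵢ⊆X → undecodable-superset F {E = E} Bᵢ⊆X (undec i) decodable))))
    ...   | no _ = at-most-one (λ i → B i ⊆? X) (λ i j i≢j Bᵢ⊆X Bⱼ⊆X → separated i j X i≢j Bᵢ⊆X Bⱼ⊆X ∣X∣≡x)

  module BlockingFamily {K} (B : Fin K → Subset m) (undec : ∀ i → ¬ DecodableSub F ℓ E (∁ (B i)))
                        {b} (isB : IsB F ℓ E b) {M} (few-shared : ∀ {i j} → i ≢ j → ∣ B i ∩ B j ∣ ≤ M) where

    size : Fin K → ℕ
    size i = ∣ B i ∣

    b≤size : ∀ i → b ≤ size i
    b≤size i with size i ℕ.<? b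
    ... | yes small = ⊥-elim (undec i (proj₂ isB (B i) small))
    ... | no  large = ℕ.≮⇒≥ large

    -- Two members have at least 2b − M edges together, so smaller sets contain at most one.
    separated : ∀ x → x + M < b + b → ∀ i j X → i ≢ j → B i ⊆ X → B j ⊆ X → ∣ X ∣ ≢ x
    separated x small i j X i≢j Bᵢ⊆X Bⱼ⊆X refl = ℕ.<-irrefl refl (begin-strict
      ∣ X ∣ + M                   <⟨ small ⟩
      b + b                       ≤⟨ +-mono-≤ (b≤size i) (b≤size j) ⟩
      size i + size j             ≤⟨ two-subsets Bᵢ⊆X Bⱼ⊆X ⟩
      ∣ X ∣ + ∣ B i ∩ B j ∣       ≤⟨ +-mono-≤ ≤-refl (few-shared i≢j) ⟩
      ∣ X ∣ + M                   ∎)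
      where open ≤-Reasoning

    members-below : ∀ x → x + M < b + b → sum (λ i → supersets (B i) x) ≤ uG x
    members-below x small = undecodable-supersets B undec x (separated x small)

    -- Each member of the minimum size b_G is itself one of the b_G-sets counted by u_{b_G}.
    minimum-members : M < b → multiplicity size b ≤ uG b
    minimum-members M<b = ≤-trans (sum-mono one) (members-below b (ℕ.+-monoʳ-< b M<b))
      where
      one : ∀ i → 𝟙 ⌊ size i ≟ b ⌋ ≤ supersets (B i) b
      one i with size i ≟ b
      ... | yes sᵢ≡b = ℕ.≤-reflexive (sym (supersets-size (B i) (trans (ℕ.+-identityʳ _) sᵢ≡b)))
      ... | no  _    = z≤n

    -- Members of size b_G and b_G + 1 lie in (b_G + y)-sets obtained by adding y, resp. y − 1,
    -- further edges.
    near-minimum-members : ∀ y → 1 ≤ y → y + M < b →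
      multiplicity size b * ((m ∸ b) C y) + multiplicity size (suc b) * ((m ∸ b ∸ 1) C (y ∸ 1)) ≤ uG (b + y)
    near-minimum-members y 1≤y y+M<b = begin
      multiplicity size b * C₁ + multiplicity size (suc b) * C₂
        ≡⟨ cong₂ _+_ (*-distribʳ-sum C₁ (λ i → 𝟙 ⌊ size i ≟ b ⌋)) (*-distribʳ-sum C₂ (λ i → 𝟙 ⌊ size i ≟ suc b ⌋)) ⟩
      sum (λ i → 𝟙 ⌊ size i ≟ b ⌋ * C₁) + sum (λ i → 𝟙 ⌊ size i ≟ suc b ⌋ * C₂)
        ≡⟨ ∑-distrib-+ (λ i → 𝟙 ⌊ size i ≟ b ⌋ * C₁) _ ⟨
      sum (λ i → 𝟙 ⌊ size i ≟ b ⌋ * C₁ + 𝟙 ⌊ size i ≟ suc b ⌋ * C₂)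
        ≤⟨ sum-mono each ⟩
      sum (λ i → supersets (B i) (b + y))
        ≤⟨ members-below (b + y) (subst (_< b + b) (sym (ℕ.+-assoc b y M)) (ℕ.+-monoʳ-< b y+M<b)) ⟩
      uG (b + y) ∎
      where
      open ≤-Reasoning
      C₁ C₂ : ℕ
      C₁ = (m ∸ b) C y
      C₂ = (m ∸ b ∸ 1) C (y ∸ 1)
      each : ∀ i → 𝟙 ⌊ size i ≟ b ⌋ * C₁ + 𝟙 ⌊ size i ≟ suc b ⌋ * C₂ ≤ supersets (B i) (b + y)
      each i with size i ≟ b | size i ≟ suc b
      ... | yes sᵢ≡b | yes sᵢ≡1+b = ⊥-elim (ℕ.<-irrefl (trans (sym sᵢ≡b) sᵢ≡1+b) (ℕ.n<1+n b))
      ... | yes sᵢ≡b | no _ = ℕ.≤-reflexive (begin-equality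
        1 * C₁ + 0 * C₂         ≡⟨ trans (ℕ.+-identityʳ _) (ℕ.*-identityˡ C₁) ⟩
        (m ∸ b) C y             ≡⟨ cong (λ s → (m ∸ s) C y) sᵢ≡b ⟨
        (m ∸ size i) C y        ≡⟨ supersets-size (B i) (cong (_+ y) sᵢ≡b) ⟨
        supersets (B i) (b + y) ∎)
      ... | no _ | yes sᵢ≡1+b = ℕ.≤-reflexive (begin-equality
        1 * C₂                        ≡⟨ ℕ.*-identityˡ C₂ ⟩
        (m ∸ b ∸ 1) C (y ∸ 1)         ≡⟨ cong (λ s → s C (y ∸ 1)) m∸b∸1 ⟩
        (m ∸ size i) C (y ∸ 1)        ≡⟨ supersets-size (B i) (trans (cong (_+ (y ∸ 1)) sᵢ≡1+b) b+y) ⟨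
        supersets (B i) (b + y)       ∎)
        where
        m∸b∸1 : m ∸ b ∸ 1 ≡ m ∸ size i
        m∸b∸1 = trans (ℕ.∸-+-assoc m b 1) (cong (m ∸_) (trans (ℕ.+-comm b 1) (sym sᵢ≡1+b)))
        b+y : suc b + (y ∸ 1) ≡ b + y
        b+y = trans (sym (ℕ.+-suc b (y ∸ 1))) (cong (b +_) (ℕ.m+[n∸m]≡n 1≤y))
      ... | no _ | no _ = z≤n

    -- If u_{b_G} + Σ ∣B i∣ = K (b_G + 1), the least value the sizes allow, then u_{b_G} is the
    -- number of members of size b_G and all other members have size b_G + 1.
    tight-bound : ∀ y → 1 ≤ y → y + M < b → uG b + sum size ≡ K * suc b →
                  uG b ≤ K × uG b * ((m ∸ b) C y) + (K ∸ uG b) * ((m ∸ b ∸ 1) C (y ∸ 1)) ≤ uG (b + y)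
    tight-bound y 1≤y y+M<b tight = u≤K , (begin
      uG b * C₁ + (K ∸ uG b) * C₂   ≡⟨ cong (λ u → u * C₁ + (K ∸ u) * C₂) u≡k₀ ⟩
      k₀ * C₁ + (K ∸ k₀) * C₂       ≤⟨ +-mono-≤ (≤-refl {k₀ * C₁}) (ℕ.*-monoˡ-≤ C₂ (ℕ.m≤n+o⇒m∸n≤o K k₀ K≤k₀+k₁)) ⟩
      k₀ * C₁ + k₁ * C₂             ≤⟨ near-minimum-members y 1≤y y+M<b ⟩
      uG (b + y)                    ∎)
      where
      open ≤-Reasoning
      C₁ C₂ k₀ k₁ : ℕ
      C₁ = (m ∸ b) C y
      C₂ = (m ∸ b ∸ 1) C (y ∸ 1)
      k₀ = multiplicity size b
      k₁ = multiplicity size (suc b)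

      M<b : M < b
      M<b = ≤-trans (s≤s (ℕ.m≤n+m M y)) y+M<b

      u≡k₀ : uG b ≡ k₀
      u≡k₀ = ℕ.≤-antisym
        (ℕ.+-cancelʳ-≤ (sum size) (uG b) k₀ (subst (_≤ k₀ + sum size) (sym tight) (excess₁ size b≤size)))
        (minimum-members M<b)

      K≤k₀+k₁ : K ≤ k₀ + k₁
      K≤k₀+k₁ = ℕ.+-cancelʳ-≤ (k₀ + sum size) K (k₀ + k₁)
        (subst (_≤ (k₀ + k₁) + (k₀ + sum size)) K[2+b] (excess₂ size b≤size))
        where
        K[2+b] : K * (2 + b) ≡ K + (k₀ + sum size)
        K[2+b] = trans (ℕ.*-suc K (suc b)) (cong (K +_) (trans (sym tight) (cong (_+ sum size) u≡k₀)))

      u≤K : uG b ≤ K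
      u≤K = subst (_≤ K) (sym u≡k₀) (≤-trans (sum-upper 1 (λ i → 𝟙≤1 ⌊ size i ≟ b ⌋)) (ℕ.≤-reflexive (ℕ.*-identityʳ K)))

-- The statement's integer and divisibility notation is opened only here: its prefix +_ and
-- infix _∣_ would make the expressions above (∣ X ∣ + …) ambiguous.
open import Level using (Level)
open import Data.Nat.Divisibility using (_∣_)
open import Data.Integer using (ℤ; +_) renaming (_+_ to _+ℤ_; _-_ to _-ℤ_; _*_ to _*ℤ_; _≤_ to _≤ℤ_)
open import Data.Integer using (+≤+)
import Data.Integer.Properties as ℤ
import Data.Integer.Tactic.RingSolver as ℤ-Solver
import Data.Nat.Tactic.RingSolver as ℕ-Solver

tightness-in-ℕ : ∀ u b n m → + u ≡ (+ (b * (n + 1) + n) -ℤ + (2 * m)) +ℤ + 1 → u + 2 * m ≡ suc n * suc b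
tightness-in-ℕ u b n m u≡θ+1 = ℤ.+-injective (begin
  + (u + 2 * m)                                          ≡⟨ ℤ.pos-+ u (2 * m) ⟩
  + u +ℤ + (2 * m)                                       ≡⟨ cong (_+ℤ + (2 * m)) u≡θ+1 ⟩
  (+ (b * (n + 1) + n) -ℤ + (2 * m)) +ℤ + 1 +ℤ + (2 * m) ≡⟨ cancel (+ (b * (n + 1) + n)) (+ (2 * m)) ⟩
  + (b * (n + 1) + n) +ℤ + 1                             ≡⟨ ℤ.pos-+ (b * (n + 1) + n) 1 ⟨
  + (b * (n + 1) + n + 1)                                ≡⟨ cong +_ (rearrange b n) ⟩
  + (suc n * suc b)                                      ∎)
  where
  open ≡-Reasoning
  cancel : ∀ a c → (a -ℤ c) +ℤ + 1 +ℤ c ≡ a +ℤ + 1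
  cancel = ℤ-Solver.solve-∀
  rearrange : ∀ b n → b * (n + 1) + n + 1 ≡ suc n * suc b
  rearrange = ℕ-Solver.solve-∀

bound-in-ℕ : ∀ {u n} (θ : ℤ) → + u ≡ θ +ℤ + 1 → u ≤ suc n → ∀ C₁ C₂ →
             (θ +ℤ + 1) *ℤ + C₁ +ℤ (+ n -ℤ θ) *ℤ + C₂ ≡ + (u * C₁ + (suc n ∸ u) * C₂)
bound-in-ℕ {u} {n} θ u≡θ+1 u≤1+n C₁ C₂ = begin
  (θ +ℤ + 1) *ℤ + C₁ +ℤ (+ n -ℤ θ) *ℤ + C₂           ≡⟨ cong₂ (λ a c → a *ℤ + C₁ +ℤ c *ℤ + C₂) (sym u≡θ+1) n-θ ⟩
  + u *ℤ + C₁ +ℤ + (suc n ∸ u) *ℤ + C₂               ≡⟨ cong₂ _+ℤ_ (ℤ.pos-* u C₁) (ℤ.pos-* (suc n ∸ u) C₂) ⟨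
  + (u * C₁) +ℤ + ((suc n ∸ u) * C₂)                 ≡⟨ ℤ.pos-+ (u * C₁) _ ⟨
  + (u * C₁ + (suc n ∸ u) * C₂)                      ∎
  where
  open ≡-Reasoning
  shift : ∀ a t → a -ℤ t ≡ (+ 1 +ℤ a) -ℤ (t +ℤ + 1)
  shift = ℤ-Solver.solve-∀
  n-θ : + n -ℤ θ ≡ + (suc n ∸ u)
  n-θ = trans (shift (+ n) θ) (trans (cong (+ suc n -ℤ_) (sym u≡θ+1))
              (trans (ℤ.m-n≡m⊖n (suc n) u) (ℤ.⊖-≥ u≤1+n)))

lemma9 : ∀ {c ℓ' : Level} (F : Field c ℓ') (q : ℕ) → HasCardinality F q → 2 ∣ q →
         (ℓ : ℕ) → 1 ≤ ℓ →
         (n m : ℕ) → 2 ≤ n → (E : Vec (Edge n) m) →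
         (dec : ∀ S → Dec (DecodableSub F ℓ E S)) →
         Decodable F ℓ E →
         (b : ℕ) → IsB F ℓ E b →
         let open Counting F ℓ E dec
             θ = (+ (b * (n + 1) + n)) -ℤ (+ (2 * m))
         in (+ uG b) ≡ θ +ℤ (+ 1) →
            ∀ (y : ℕ) → 1 ≤ y → y + (Ω E ⊔ ΔL E) + 1 ≤ b →
            ((θ +ℤ (+ 1)) *ℤ (+ ((m ∸ b) C y)) +ℤ ((+ n -ℤ θ) *ℤ (+ ((m ∸ b ∸ 1) C (y ∸ 1)))))
              ≤ℤ (+ uG (b + y))
lemma9 F q card 2∣q ℓ 1≤ℓ n m 2≤n E dec _ b isB u≡θ+1 y 1≤y y+M+1≤b =
  subst (_≤ℤ + uG (b + y)) (sym (bound-in-ℕ θ u≡θ+1 u≤1+n _ _)) (+≤+ natural-bound)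
  where
  open Counting F ℓ E dec
  θ : ℤ
  θ = (+ (b * (n + 1) + n)) -ℤ (+ (2 * m))

  coordinate : Fin ℓ
  coordinate = fromℕ< 1≤ℓ
  vertex : Fin n
  vertex = fromℕ< (≤-trans (s≤s z≤n) 2≤n)

  open BlockingFamily F ℓ E dec (blocking E)
         (blocking-undecodable F coordinate vertex (even-characteristic-two F card 2∣q) E) isB (blocking-overlap E)

  tight : uG b + sum size ≡ suc n * suc b
  tight = trans (cong (λ s → uG b + s) (blocking-sizes E)) (tightness-in-ℕ (uG b) b n m u≡θ+1)

  y+M<b : y + (Ω E ⊔ ΔL E) < b
  y+M<b = subst (_≤ b) (ℕ.+-comm _ 1) y+M+1≤b

  u≤1+n : uG b ≤ suc n
  u≤1+n = proj₁ (tight-bound y 1≤y y+M<b tight)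

  natural-bound : uG b * ((m ∸ b) C y) + (suc n ∸ uG b) * ((m ∸ b ∸ 1) C (y ∸ 1)) ≤ uG (b + y)
  natural-bound = proj₂ (tight-bound y 1≤y y+M<b tight)
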